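{- For every raw term $t$, $\mathrm{fa}(t)\subseteq\mathrm{supp}(t)$.
   Context: Fix pairwise disjoint countably infinite sets $\mathbb{A}_\alpha$ of atoms (one per atom sort), $\mathbb{A}=\bigcup_\alpha\mathbb{A}_\alpha$. Renamings are maps $\rho:\mathbb{A}\to\mathbb{A}$ preserving sorts and fixing all but finitely many atoms; $\rho_1;\rho_2=\rho_2\circ\rho_1$; $\mathrm{supp}(\rho)=\{a,\rho(a)\mid\rho(a)\ne a\}$. Over a nominal signature (base sorts, atom sorts, function symbols $f:\sigma\to\delta$, variables of each sort), raw terms are: variables $x$, atoms $a$, moderated terms $\mathrm{mod}(t,\rho)$ ($\rho$ a renaming), abstractions $[a]t$, tuples $(t_1,\ldots,t_k)$, and $f(t)$. Support: $\mathrm{supp}(x)=\emptyset$, $\mathrm{supp}(a)=\{a\}$, $\mathrm{supp}(\mathrm{mod}(t,\rho))=\mathrm{supp}(t)\cup\mathrm{supp}(\rho)$, $\mathrm{supp}([a]t)=\{a\}\cup\mathrm{supp}(t)$, $\mathrm{supp}((t_1,\ldots,t_k))=\bigcup_i\mathrm{supp}(t_i)$, $\mathrm{supp}(f(t))=\mathrm{supp}(t)$. Renaming action: $x[\rho]=x$, $a[\rho]=\rho(a)$, $\mathrm{mod}(t,\rho_1)[\rho]=\mathrm{mod}(t,\rho_1;\rho)$, $([a]t)[\rho]=[\rho(a)](t[\rho])$, componentwise on tuples and $f(t)$. Free atoms: $\mathrm{fa}(x)=\emptyset$, $\mathrm{fa}(a)=\{a\}$, $\mathrm{fa}(\mathrm{mod}(t,\rho))=\mathrm{fa}(t[\rho])$,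 $\mathrm{fa}([a]t)=\mathrm{fa}(t)\setminus\{a\}$, $\mathrm{fa}((t_1,\ldots,t_k))=\bigcup_i\mathrm{fa}(t_i)$, $\mathrm{fa}(f(t))=\mathrm{fa}(t)$. -}

module Defs where

open import Data.Nat using (ℕ)
open import Data.Product using (Σ; ∃; _×_; _,_; proj₁)
open import Data.Sum using (_⊎_)
open import Data.List using (List; []; _∷_; _++_)
open import Data.List.Membership.Propositional using (_∈_; _∉_)
open import Data.List.Relation.Unary.Any using (Any)
open import Relation.Binary.PropositionalEquality using (_≡_; _≢_)
open import Relation.Unary using (Pred; _∪_; _⊆_)

-- Atoms of atom sort α: the countably infinite set 𝔸_α ≅ ℕ.
-- An atom is a pair (α , n); the sets 𝔸_α are pairwise disjoint.
Atom : Set → Set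
Atom AS = Σ AS (λ _ → ℕ)

sort : {AS : Set} → Atom AS → AS
sort = proj₁

record Renaming (AS : Set) : Set where
  constructor mkRen
  field
    fun      : Atom AS → Atom AS
    sortPres : ∀ a → sort (fun a) ≡ sort a
    dom      : List (Atom AS)
    finite   : ∀ a → a ∉ dom → fun a ≡ a
open Renaming public

_︔_ : {AS : Set} → Renaming AS → Renaming AS → Renaming AS
_︔_ {AS} ρ₁ ρ₂ = mkRen f sp (dom ρ₁ ++ dom ρ₂) fin
  where
  open import Relation.Binary.PropositionalEquality using (trans; cong)
  open import Data.List.Membership.Propositional.Properties using (∈-++⁺ˡ; ∈-++⁺ʳ)
  f : Atom AS → Atom AS
  f a = fun ρ₂ (fun ρ₁ a)
  sp : ∀ a → sort (f a) ≡ sort a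
  sp a = trans (sortPres ρ₂ (fun ρ₁ a)) (sortPres ρ₁ a)
  fin : ∀ a → a ∉ dom ρ₁ ++ dom ρ₂ → f a ≡ a
  fin a a∉ = trans (cong (fun ρ₂) (finite ρ₁ a (λ i → a∉ (∈-++⁺ˡ i))))
                   (finite ρ₂ a (λ i → a∉ (∈-++⁺ʳ (dom ρ₁) i)))

suppRen : {AS : Set} → Renaming AS → Pred (Atom AS) _
suppRen ρ c = (fun ρ c ≢ c) ⊎ (∃ λ a → (fun ρ a ≢ a) × (fun ρ a ≡ c))

data Sort (AS BS : Set) : Set where
  base  : BS → Sort AS BS
  atom  : AS → Sort AS BS
  abs   : AS → Sort AS BS → Sort AS BS
  prod  : List (Sort AS BS) → Sort AS BS

record Signature : Set₁ where
  field
    AtomSort BaseSort FunSym Var : Set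
    arity   : FunSym → Sort AtomSort BaseSort × BaseSort
    varSort : Var → Sort AtomSort BaseSort
open Signature public

data Term (Σ' : Signature) : Set where
  var  : Var Σ' → Term Σ'
  atm  : Atom (AtomSort Σ') → Term Σ'
  mod  : Term Σ' → Renaming (AtomSort Σ') → Term Σ'
  abst : Atom (AtomSort Σ') → Term Σ' → Term Σ'
  tup  : List (Term Σ') → Term Σ'
  app  : FunSym Σ' → Term Σ' → Term Σ'

module _ {Σ' : Signature} where
  private
    A = Atom (AtomSort Σ')
    R = Renaming (AtomSort Σ')

  supp : Term Σ' → Pred A _
  suppList : List (Term Σ') → Pred A _
  supp (var x) c = Data.Empty.⊥ where import Data.Empty
  supp (atm a) c = c ≡ a
  supp (mod t ρ) c = supp t c ⊎ suppRen ρ c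
  supp (abst a t) c = (c ≡ a) ⊎ supp t c
  supp (tup ts) c = suppList ts c
  supp (app f t) c = supp t c
  suppList [] c = Data.Empty.⊥ where import Data.Empty
  suppList (t ∷ ts) c = supp t c ⊎ suppList ts c

  _[_] : Term Σ' → R → Term Σ'
  renList : List (Term Σ') → R → List (Term Σ')
  var x [ ρ ] = var x
  atm a [ ρ ] = atm (fun ρ a)
  mod t ρ₁ [ ρ ] = mod t (ρ₁ ︔ ρ)
  abst a t [ ρ ] = abst (fun ρ a) (t [ ρ ])
  tup ts [ ρ ] = tup (renList ts ρ)
  app f t [ ρ ] = app f (t [ ρ ])
  renList [] ρ = []
  renList (t ∷ ts) ρ = (t [ ρ ]) ∷ renList ts ρ

  -- free atoms, as the least predicate satisfying the defining equations
  -- (fa(mod(t,ρ)) = fa(t[ρ]) is not structurally recursive)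
  data fa : Term Σ' → Pred A Agda.Primitive.lzero where
    fa-atm  : ∀ {a} → fa (atm a) a
    fa-mod  : ∀ {t ρ c} → fa (t [ ρ ]) c → fa (mod t ρ) c
    fa-abst : ∀ {a t c} → fa t c → c ≢ a → fa (abst a t) c
    fa-tup  : ∀ {ts c} → Any (λ t → fa t c) ts → fa (tup ts) c
    fa-app  : ∀ {f t c} → fa t c → fa (app f t) c

-- The induction is on the derivation of c ∈ fa(t), since fa(mod(t,ρ)) is defined through t[ρ],
-- which is not a subterm of mod(t,ρ). That case needs supp(t[ρ]) ⊆ supp(t) ∪ supp(ρ): a renaming
-- can only introduce an atom c = ρ(a) ≠ a, and such a c lies in supp(ρ) by definition.
module Submission where

open import Defs
open import Relation.Unary using (_⊆_; _∪_)
open import Data.Nat using (_≟_)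
open import Data.Product using (_,_; proj₂)
open import Data.Sum using (inj₁; inj₂; map₁)
open import Data.List using (List; _∷_)
open import Data.List.Relation.Unary.Any using (Any; here; there)
open import Relation.Nullary using (Dec; yes; no)
open import Relation.Binary.PropositionalEquality using (_≡_; refl; sym; trans; cong)

module _ {AS : Set} where

  -- AS need not have decidable equality, but ρ preserves sorts, so only the ℕ index can change.
  fixed? : (ρ : Renaming AS) (a : Atom AS) → Dec (fun ρ a ≡ a)
  fixed? ρ (α , n) with fun ρ (α , n) | sortPres ρ (α , n)
  ... | (.α , m) | refl with m ≟ n
  ...   | yes refl = yes refl
  ...   | no m≢n   = no (λ e → m≢n (cong proj₂ e))

  image⊆self∪suppRen : (ρ : Renaming AS) (a : Atom AS) →
                       (λ c → c ≡ fun ρ a) ⊆ (λ c → c ≡ a) ∪ suppRen ρ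
  image⊆self∪suppRen ρ a c≡ρa with fixed? ρ a
  ... | yes ρa≡a = inj₁ (trans c≡ρa ρa≡a)
  ... | no  ρa≢a = inj₂ (inj₂ (a , ρa≢a , sym c≡ρa))

  suppRen-︔ : (ρ₁ ρ₂ : Renaming AS) → suppRen (ρ₁ ︔ ρ₂) ⊆ suppRen ρ₁ ∪ suppRen ρ₂
  suppRen-︔ ρ₁ ρ₂ {c} (inj₁ ρ₂ρ₁c≢c) with fixed? ρ₁ c
  ... | yes ρ₁c≡c = inj₂ (inj₁ (λ ρ₂c≡c → ρ₂ρ₁c≢c (trans (cong (fun ρ₂) ρ₁c≡c) ρ₂c≡c)))
  ... | no  ρ₁c≢c = inj₁ (inj₁ ρ₁c≢c)
  suppRen-︔ ρ₁ ρ₂ (inj₂ (a , ρ₂ρ₁a≢a , ρ₂ρ₁a≡c)) with fixed? ρ₂ (fun ρ₁ a)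
  ... | yes ρ₂b≡b = inj₁ (inj₂ (a , (λ ρ₁a≡a → ρ₂ρ₁a≢a (trans ρ₂b≡b ρ₁a≡a)) , trans (sym ρ₂b≡b) ρ₂ρ₁a≡c))
  ... | no  ρ₂b≢b = inj₂ (inj₂ (fun ρ₁ a , ρ₂b≢b , ρ₂ρ₁a≡c))

module _ {Σ' : Signature} where

  supp-[] : (t : Term Σ') (ρ : Renaming (AtomSort Σ')) → supp (t [ ρ ]) ⊆ supp t ∪ suppRen ρ
  suppList-renList : (ts : List (Term Σ')) (ρ : Renaming (AtomSort Σ')) →
                     suppList (renList ts ρ) ⊆ suppList ts ∪ suppRen ρ
  supp-[] (var x)    ρ ()
  supp-[] (atm a)    ρ c≡ρa          = image⊆self∪suppRen ρ a c≡ρa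
  supp-[] (mod t ρ₁) ρ (inj₁ c∈t)    = inj₁ (inj₁ c∈t)
  supp-[] (mod t ρ₁) ρ (inj₂ c∈ρ₁ρ)  = map₁ inj₂ (suppRen-︔ ρ₁ ρ c∈ρ₁ρ)
  supp-[] (abst a t) ρ (inj₁ c≡ρa)   = map₁ inj₁ (image⊆self∪suppRen ρ a c≡ρa)
  supp-[] (abst a t) ρ (inj₂ c∈tρ)   = map₁ inj₂ (supp-[] t ρ c∈tρ)
  supp-[] (tup ts)   ρ c∈tsρ         = suppList-renList ts ρ c∈tsρ
  supp-[] (app f t)  ρ c∈tρ          = supp-[] t ρ c∈tρ
  suppList-renList (t ∷ ts) ρ (inj₁ c∈tρ)  = map₁ inj₁ (supp-[] t ρ c∈tρ)
  suppList-renList (t ∷ ts) ρ (inj₂ c∈tsρ) = map₁ inj₂ (suppList-renList ts ρ c∈tsρ)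

  fa⊆supp : (t : Term Σ') → fa t ⊆ supp t
  any-fa⊆suppList : (ts : List (Term Σ')) → (λ c → Any (λ t → fa t c) ts) ⊆ suppList ts
  fa⊆supp (atm a)    fa-atm            = refl
  fa⊆supp (mod t ρ)  (fa-mod c∈tρ)     = supp-[] t ρ (fa⊆supp (t [ ρ ]) c∈tρ)
  fa⊆supp (abst a t) (fa-abst c∈t _)   = inj₂ (fa⊆supp t c∈t)
  fa⊆supp (tup ts)   (fa-tup c∈ts)     = any-fa⊆suppList ts c∈ts
  fa⊆supp (app f t)  (fa-app c∈t)      = fa⊆supp t c∈t
  any-fa⊆suppList (t ∷ ts) (here c∈t)  = inj₁ (fa⊆supp t c∈t)
  any-fa⊆suppList (t ∷ ts) (there c∈ts) = inj₂ (any-fa⊆suppList ts c∈ts)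

lemma3p5 : {Σ' : Signature} (t : Term Σ') → fa t ⊆ supp t
lemma3p5 = fa⊆supp
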